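{- Let $K$ be a field, let $d\ge 2$ with $\operatorname{char}K\nmid d$, and let $F(X,Y)\in K[X,Y]$ be homogeneous of degree $d$ with no multiple roots. Let $\phi_F=[F_Y:-F_X]:\mathbb{P}^1\to\mathbb{P}^1$. Then the fixed points of $\phi_F$ are exactly the points $(X:Y)$ with $F(X,Y)=0$, and the multiplier of $\phi_F$ at each fixed point equals $1-d$.
   Context: If $P$ is a fixed point of a rational map $\phi$ on $\mathbb{P}^1$, its multiplier is $\tilde\phi'(P)$, where $\tilde\phi$ is the expression of $\phi$ in an affine coordinate in which $P$ is a finite point (for the point at infinity one first changes coordinates). -}

module Defs where

open import Level using (Level; _⊔_) renaming (suc to lsuc)
open import Algebra.Bundles using (CommutativeRing)
open import Data.Nat using (ℕ; zero; suc)
import Data.Nat as ℕ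
open import Data.Fin using (Fin; zero; suc; toℕ; inject₁; opposite)
open import Data.Product using (Σ; _×_; _,_)
open import Data.Bool using (if_then_else_)
open import Relation.Nullary using (¬_; does)

-- A field: a commutative ring with 0 ≠ 1 in which every nonzero element
-- has a multiplicative inverse (given by a total function _⁻¹, whose value
-- at 0 is irrelevant).
record Field (c ℓ : Level) : Set (lsuc (c ⊔ ℓ)) where
  field
    commutativeRing : CommutativeRing c ℓ
  open CommutativeRing commutativeRing public
  field
    _⁻¹        : Carrier → Carrier
    ⁻¹-inverse : ∀ x → ¬ (x ≈ 0#) → (x * (x ⁻¹)) ≈ 1#
    0≉1        : ¬ (0# ≈ 1#)

module FieldTheory {c ℓ : Level} (K : Field c ℓ) where
  open Field K public hiding (zero)

  Σ[_] : (n : ℕ) → (Fin n → Carrier) → Carrier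
  Σ[ zero ] f = 0#
  Σ[ suc n ] f = f zero + Σ[ n ] (λ i → f (suc i))

  _^_ : Carrier → ℕ → Carrier
  x ^ zero = 1#
  x ^ suc k = x * (x ^ k)

  fromℕ : ℕ → Carrier
  fromℕ zero = 0#
  fromℕ (suc k) = 1# + fromℕ k

  -- Binary forms.  A homogeneous polynomial of degree m in K[X,Y] is
  -- given by its coefficients:  F = Σ_{i=0}^{m} F i · X^i Y^(m-i).
  Form : ℕ → Set c
  Form m = Fin (suc m) → Carrier

  evalForm : {m : ℕ} → Form m → Carrier → Carrier → Carrier
  evalForm {m} F x y = Σ[ suc m ] (λ i → F i * ((x ^ toℕ i) * (y ^ (m ℕ.∸ toℕ i))))

  ∂X : {m : ℕ} → Form (suc m) → Form m
  ∂X F j = fromℕ (suc (toℕ j)) * F (suc j)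

  ∂Y : {m : ℕ} → Form (suc m) → Form m
  ∂Y {m} F j = fromℕ (suc m ℕ.∸ toℕ j) * F (inject₁ j)

  negForm : {m : ℕ} → Form m → Form m
  negForm F i = - F i

  mulForm : {p q : ℕ} → Form p → Form q → Form (p ℕ.+ q)
  mulForm {p} {q} A B k =
    Σ[ suc p ] (λ i → Σ[ suc q ] (λ j →
      if does (toℕ i ℕ.+ toℕ j ℕ.≟ toℕ k) then A i * B j else 0#))

  -- the square of the linear form  bX - aY  (vanishing at (a:b))
  sqLinear : Carrier → Carrier → Form 2
  sqLinear a b zero = a * a
  sqLinear a b (suc zero) = - ((a * b) + (a * b))
  sqLinear a b (suc (suc zero)) = b * b

  -- (a,b) represents a point of P¹(K)
  NonZeroPair : Carrier → Carrier → Set ℓ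
  NonZeroPair a b = ¬ ((a ≈ 0#) × (b ≈ 0#))

  HasMultipleRoot : {n : ℕ} → Form (suc (suc n)) → Set (c ⊔ ℓ)
  HasMultipleRoot {n} F =
    Σ Carrier λ a → Σ Carrier λ b → NonZeroPair a b ×
      Σ (Form n) λ G → (∀ k → F k ≈ mulForm (sqLinear a b) G k)

  IsFixedPoint : {m : ℕ} → Form (suc m) → Carrier → Carrier → Set ℓ
  IsFixedPoint F a b =
    NonZeroPair (evalForm (∂Y F) a b) (- evalForm (∂X F) a b) ×
    ((evalForm (∂Y F) a b * b) ≈ ((- evalForm (∂X F) a b) * a))

  Poly : ℕ → Set c
  Poly m = Fin (suc m) → Carrier

  evalPoly : {m : ℕ} → Poly m → Carrier → Carrier
  evalPoly {m} p x = Σ[ suc m ] (λ i → p i * (x ^ toℕ i))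

  evalDeriv : {m : ℕ} → Poly m → Carrier → Carrier
  evalDeriv {m} p x = Σ[ suc m ] (λ i → (fromℕ (toℕ i) * p i) * (x ^ (toℕ i ℕ.∸ 1)))

  -- dehomogenisations: affine chart x = X/Y  (point (x:1)) and
  -- chart at infinity y = Y/X  (point (1:y)).
  dehomY : {m : ℕ} → Form m → Poly m
  dehomY F i = F i

  dehomX : {m : ℕ} → Form m → Poly m
  dehomX F k = F (opposite k) -- F(1,y) = Σ F (m-k) y^k

  ratDeriv : {m : ℕ} → Poly m → Poly m → Carrier → Carrier
  ratDeriv P Q t =
    ((evalDeriv P t * evalPoly Q t) - (evalPoly P t * evalDeriv Q t))
      * ((evalPoly Q t * evalPoly Q t) ⁻¹)

  -- Multiplier of φ_F at a finite fixed point (a:1): in the coordinate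
  -- x = X/Y, φ_F is  x ↦ F_Y(x,1) / (-F_X(x,1)).
  multiplierFinite : {m : ℕ} → Form (suc m) → Carrier → Carrier
  multiplierFinite F a = ratDeriv (dehomY (∂Y F)) (dehomY (negForm (∂X F))) a

  -- Multiplier of φ_F at the fixed point ∞ = (1:0): in the coordinate
  -- y = Y/X, φ_F is  y ↦ -F_X(1,y) / F_Y(1,y), evaluated at y = 0.
  multiplierInfinity : {m : ℕ} → Form (suc m) → Carrier
  multiplierInfinity F = ratDeriv (dehomX (negForm (∂X F))) (dehomX (∂Y F)) 0#

module Submission where

-- Euler's identity  X F_X + Y F_Y = d F  shows that a point where [F_Y : -F_X] is
-- defined is sent to itself exactly when d F(a,b) = 0.  The map is undefined only where
-- F, F_X and F_Y vanish together; dehomogenising, such a point is a common root of f and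
-- f′, so synthetic division by x - r twice (or, at ∞, two vanishing leading coefficients)
-- exhibits a square factor of F.  At a finite fixed point the quotient rule, with Euler's
-- identity for F_X eliminating F_XY, gives the multiplier -(d - 1); at ∞ it is read off
-- the coefficient of X^(d-1) Y in F.

open import Defs
open import Level using (Level)
open import Data.Nat using (ℕ; zero; suc; _∸_)
import Data.Nat as ℕ
import Data.Nat.Properties as ℕ
open import Data.Fin using (Fin; zero; suc; toℕ; inject₁)
import Data.Fin as Fin
open import Data.Fin.Properties using (toℕ-inject₁; toℕ-fromℕ; toℕ≤pred[n])
open import Data.Vec.Functional using (tail; init)
open import Data.Product using (_×_; _,_)
open import Data.Bool using (if_then_else_)
open import Function using (_∘_)
open import Relation.Nullary using (¬_; does; yes; no)
open import Relation.Nullary.Decidable using (¬¬-excluded-middle)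
import Relation.Binary.PropositionalEquality as ≡
import Algebra.Properties.Ring as RingProperties
import Algebra.Properties.CommutativeSemigroup as CommutativeSemigroupProperties
import Algebra.Solver.CommutativeMonoid as CommutativeMonoidSolver

module BinaryForms {c ℓ : Level} (K : Field c ℓ) where
  open FieldTheory K
  open RingProperties ring
    using (-‿distribˡ-*; -‿distribʳ-*; -‿involutive; -0#≈0#; -‿+-comm; +-inverseʳ-unique; xyx⁻¹≈y)
  open CommutativeSemigroupProperties +-commutativeSemigroup
    using () renaming (x∙yz≈y∙xz to x+[y+z]≈y+[x+z]; interchange to +-interchange)
  open CommutativeSemigroupProperties *-commutativeSemigroup
    using () renaming (x∙yz≈y∙xz to x*[y*z]≈y*[x*z]; interchange to *-interchange)
  open import Relation.Binary.Reasoning.Setoid setoid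
  module *-Solver = CommutativeMonoidSolver *-commutativeMonoid

  x≈0⇒-x≈0 : ∀ {x} → x ≈ 0# → - x ≈ 0#
  x≈0⇒-x≈0 x≈0 = trans (-‿cong x≈0) -0#≈0#

  -x≈0⇒x≈0 : ∀ {x} → - x ≈ 0# → x ≈ 0#
  -x≈0⇒x≈0 {x} -x≈0 = trans (sym (-‿involutive x)) (x≈0⇒-x≈0 -x≈0)

  -x*-y≈x*y : ∀ x y → (- x) * (- y) ≈ x * y
  -x*-y≈x*y x y = begin
    (- x) * (- y)  ≈⟨ -‿distribˡ-* x (- y) ⟨
    - (x * (- y))  ≈⟨ -‿cong (-‿distribʳ-* x y) ⟨
    - (- (x * y))  ≈⟨ -‿involutive (x * y) ⟩
    x * y          ∎

  x+y≈z⇒y≈z-x : ∀ {x y z} → x + y ≈ z → y ≈ z - x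
  x+y≈z⇒y≈z-x {x} {y} x+y≈z = trans (sym (xyx⁻¹≈y x y)) (+-congʳ x+y≈z)

  x*y≈0⇒y≈0 : ∀ {x y} → x ≉ 0# → x * y ≈ 0# → y ≈ 0#
  x*y≈0⇒y≈0 {x} {y} x≉0 xy≈0 = begin
    y               ≈⟨ *-identityˡ y ⟨
    1# * y          ≈⟨ *-congʳ (⁻¹-inverse x x≉0) ⟨
    (x * x ⁻¹) * y  ≈⟨ *-congʳ (*-comm x (x ⁻¹)) ⟩
    (x ⁻¹ * x) * y  ≈⟨ *-assoc (x ⁻¹) x y ⟩
    x ⁻¹ * (x * y)  ≈⟨ *-congˡ xy≈0 ⟩
    x ⁻¹ * 0#       ≈⟨ zeroʳ (x ⁻¹) ⟩
    0#              ∎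

  *-≉0 : ∀ {x y} → x ≉ 0# → y ≉ 0# → x * y ≉ 0#
  *-≉0 x≉0 y≉0 xy≈0 = y≉0 (x*y≈0⇒y≈0 x≉0 xy≈0)

  x*y*y⁻¹≈x : ∀ x {y} → y ≉ 0# → (x * y) * y ⁻¹ ≈ x
  x*y*y⁻¹≈x x {y} y≉0 = begin
    (x * y) * y ⁻¹  ≈⟨ *-assoc x y (y ⁻¹) ⟩
    x * (y * y ⁻¹)  ≈⟨ *-congˡ (⁻¹-inverse y y≉0) ⟩
    x * 1#          ≈⟨ *-identityʳ x ⟩
    x               ∎

  ^-congˡ : ∀ {x y} k → x ≈ y → x ^ k ≈ y ^ k
  ^-congˡ zero    x≈y = refl
  ^-congˡ (suc k) x≈y = *-cong x≈y (^-congˡ k x≈y)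

  ^-homo-* : ∀ x i j → x ^ (i ℕ.+ j) ≈ x ^ i * x ^ j
  ^-homo-* x zero    j = sym (*-identityˡ _)
  ^-homo-* x (suc i) j = trans (*-congˡ (^-homo-* x i j)) (sym (*-assoc _ _ _))

  ^-distrib-* : ∀ x y k → (x * y) ^ k ≈ x ^ k * y ^ k
  ^-distrib-* x y zero    = sym (*-identityˡ 1#)
  ^-distrib-* x y (suc k) = trans (*-congˡ (^-distrib-* x y k)) (*-interchange x y _ _)

  1^k≈1 : ∀ k → 1# ^ k ≈ 1#
  1^k≈1 zero    = refl
  1^k≈1 (suc k) = trans (*-identityˡ _) (1^k≈1 k)

  ^-≉0 : ∀ {x} k → x ≉ 0# → x ^ k ≉ 0#
  ^-≉0 zero    x≉0 1≈0 = 0≉1 (sym 1≈0)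
  ^-≉0 (suc k) x≉0     = *-≉0 x≉0 (^-≉0 k x≉0)

  fromℕ-homo-+ : ∀ m n → fromℕ (m ℕ.+ n) ≈ fromℕ m + fromℕ n
  fromℕ-homo-+ zero    n = sym (+-identityˡ _)
  fromℕ-homo-+ (suc m) n = trans (+-congˡ (fromℕ-homo-+ m n)) (sym (+-assoc _ _ _))

  1-[2+n]≈-[1+n] : ∀ n → 1# - fromℕ (suc (suc n)) ≈ - fromℕ (suc n)
  1-[2+n]≈-[1+n] n = begin
    1# + - (1# + M)     ≈⟨ +-congˡ (-‿+-comm 1# M) ⟨
    1# + (- 1# + - M)   ≈⟨ +-assoc 1# (- 1#) (- M) ⟨
    (1# + - 1#) + - M   ≈⟨ +-congʳ (-‿inverseʳ 1#) ⟩
    0# + - M            ≈⟨ +-identityˡ (- M) ⟩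
    - M                 ∎
    where M = fromℕ (suc n)

  Σ-cong : ∀ n {f g : Fin n → Carrier} → (∀ i → f i ≈ g i) → Σ[ n ] f ≈ Σ[ n ] g
  Σ-cong zero    f≈g = refl
  Σ-cong (suc n) f≈g = +-cong (f≈g zero) (Σ-cong n (f≈g ∘ suc))

  Σ-≈0 : ∀ n {f : Fin n → Carrier} → (∀ i → f i ≈ 0#) → Σ[ n ] f ≈ 0#
  Σ-≈0 zero    f≈0 = refl
  Σ-≈0 (suc n) f≈0 = trans (+-cong (f≈0 zero) (Σ-≈0 n (f≈0 ∘ suc))) (+-identityˡ 0#)

  Σ-distrib-+ : ∀ n (f g : Fin n → Carrier) → Σ[ n ] (λ i → f i + g i) ≈ Σ[ n ] f + Σ[ n ] g
  Σ-distrib-+ zero    f g = sym (+-identityˡ 0#)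
  Σ-distrib-+ (suc n) f g =
    trans (+-congˡ (Σ-distrib-+ n (f ∘ suc) (g ∘ suc))) (+-interchange _ _ _ _)

  *-distribˡ-Σ : ∀ n x (f : Fin n → Carrier) → x * Σ[ n ] f ≈ Σ[ n ] (λ i → x * f i)
  *-distribˡ-Σ zero    x f = zeroʳ x
  *-distribˡ-Σ (suc n) x f = trans (distribˡ x (f zero) _) (+-congˡ (*-distribˡ-Σ n x (f ∘ suc)))

  -‿distrib-Σ : ∀ n (f : Fin n → Carrier) → - Σ[ n ] f ≈ Σ[ n ] (λ i → - f i)
  -‿distrib-Σ zero    f = -0#≈0#
  -‿distrib-Σ (suc n) f = trans (sym (-‿+-comm (f zero) _)) (+-congˡ (-‿distrib-Σ n (f ∘ suc)))

  Σ-init-last : ∀ n (f : Fin (suc n) → Carrier) → Σ[ suc n ] f ≈ Σ[ n ] (init f) + f (Fin.fromℕ n)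
  Σ-init-last zero    f = +-comm (f zero) 0#
  Σ-init-last (suc n) f = trans (+-congˡ (Σ-init-last n (f ∘ suc))) (sym (+-assoc _ _ _))

  evalPoly-horner : ∀ {k} (p : Poly (suc k)) x → evalPoly p x ≈ p zero + x * evalPoly (tail p) x
  evalPoly-horner {k} p x = +-cong (*-identityʳ (p zero)) (begin
    Σ[ suc k ] (λ j → p (suc j) * (x * x ^ toℕ j))
      ≈⟨ Σ-cong (suc k) (λ j → x*[y*z]≈y*[x*z] (p (suc j)) x (x ^ toℕ j)) ⟩
    Σ[ suc k ] (λ j → x * (p (suc j) * x ^ toℕ j))
      ≈⟨ *-distribˡ-Σ (suc k) x (λ j → p (suc j) * x ^ toℕ j) ⟨
    x * evalPoly (tail p) x ∎)

  evalPoly-const : ∀ (p : Poly 0) x → evalPoly p x ≈ p zero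
  evalPoly-const p x = trans (+-identityʳ _) (*-identityʳ _)

  evalPoly-at-0 : ∀ {k} (p : Poly k) → evalPoly p 0# ≈ p zero
  evalPoly-at-0 {zero}  p = evalPoly-const p 0#
  evalPoly-at-0 {suc k} p =
    trans (evalPoly-horner p 0#) (trans (+-congˡ (zeroˡ _)) (+-identityʳ _))

  evalPoly-neg : ∀ {m} (p : Poly m) x → evalPoly (λ i → - p i) x ≈ - evalPoly p x
  evalPoly-neg {m} p x = trans (Σ-cong (suc m) (λ i → sym (-‿distribˡ-* (p i) (x ^ toℕ i))))
                               (sym (-‿distrib-Σ (suc m) (λ i → p i * x ^ toℕ i)))

  evalDeriv-const : ∀ (p : Poly 0) x → evalDeriv p x ≈ 0#
  evalDeriv-const p x = trans (+-identityʳ _) (trans (*-identityʳ _) (zeroˡ _))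

  evalDeriv-horner : ∀ {k} (p : Poly (suc k)) x →
    evalDeriv p x ≈ evalPoly (tail p) x + x * evalDeriv (tail p) x
  evalDeriv-horner {k} p x = begin
    (fromℕ 0 * p zero) * 1# + Σ[ suc k ] (λ j → (fromℕ (suc (toℕ j)) * p (suc j)) * x ^ toℕ j)
      ≈⟨ +-congʳ (trans (*-identityʳ _) (zeroˡ _)) ⟩
    0# + Σ[ suc k ] (λ j → (fromℕ (suc (toℕ j)) * p (suc j)) * x ^ toℕ j)
      ≈⟨ +-identityˡ _ ⟩
    Σ[ suc k ] (λ j → (fromℕ (suc (toℕ j)) * p (suc j)) * x ^ toℕ j)
      ≈⟨ Σ-cong (suc k) (λ j → product-rule (toℕ j) (p (suc j))) ⟩
    Σ[ suc k ] (λ j → p (suc j) * x ^ toℕ j + x * ((fromℕ (toℕ j) * p (suc j)) * x ^ (toℕ j ∸ 1)))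
      ≈⟨ Σ-distrib-+ (suc k) (λ j → p (suc j) * x ^ toℕ j)
                             (λ j → x * ((fromℕ (toℕ j) * p (suc j)) * x ^ (toℕ j ∸ 1))) ⟩
    evalPoly (tail p) x + Σ[ suc k ] (λ j → x * ((fromℕ (toℕ j) * p (suc j)) * x ^ (toℕ j ∸ 1)))
      ≈⟨ +-congˡ (*-distribˡ-Σ (suc k) x (λ j → (fromℕ (toℕ j) * p (suc j)) * x ^ (toℕ j ∸ 1))) ⟨
    evalPoly (tail p) x + x * evalDeriv (tail p) x ∎
    where
    product-rule : ∀ t a → (fromℕ (suc t) * a) * x ^ t ≈ a * x ^ t + x * ((fromℕ t * a) * x ^ (t ∸ 1))
    product-rule zero a = begin
      ((1# + 0#) * a) * 1#              ≈⟨ *-congʳ (trans (*-congʳ (+-identityʳ 1#)) (*-identityˡ a)) ⟩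
      a * 1#                            ≈⟨ +-identityʳ _ ⟨
      a * 1# + 0#                       ≈⟨ +-congˡ (trans (*-congˡ (trans (*-identityʳ _) (zeroˡ a))) (zeroʳ x)) ⟨
      a * 1# + x * ((0# * a) * 1#)      ∎
    product-rule (suc t) a = begin
      ((1# + f) * a) * (x * x ^ t)            ≈⟨ *-congʳ (distribʳ a 1# f) ⟩
      (1# * a + f * a) * (x * x ^ t)          ≈⟨ distribʳ _ (1# * a) (f * a) ⟩
      (1# * a) * (x * x ^ t) + (f * a) * (x * x ^ t)
        ≈⟨ +-cong (*-congʳ (*-identityˡ a)) (x*[y*z]≈y*[x*z] (f * a) x (x ^ t)) ⟩
      a * (x * x ^ t) + x * ((f * a) * x ^ t) ∎
      where f = fromℕ (suc t)

  evalDeriv-at-0 : ∀ {k} (p : Poly (suc k)) → evalDeriv p 0# ≈ p (suc zero)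
  evalDeriv-at-0 p =
    trans (evalDeriv-horner p 0#) (trans (+-cong (evalPoly-at-0 (tail p)) (zeroˡ _)) (+-identityʳ _))

  evalDeriv-neg : ∀ {m} (p : Poly m) x → evalDeriv (λ i → - p i) x ≈ - evalDeriv p x
  evalDeriv-neg {m} p x = trans (Σ-cong (suc m) neg-term)
                                (sym (-‿distrib-Σ (suc m) (λ i → (fromℕ (toℕ i) * p i) * x ^ (toℕ i ∸ 1))))
    where
    neg-term : ∀ i → (fromℕ (toℕ i) * - p i) * x ^ (toℕ i ∸ 1) ≈ - ((fromℕ (toℕ i) * p i) * x ^ (toℕ i ∸ 1))
    neg-term i = trans (*-congʳ (sym (-‿distribʳ-* _ (p i)))) (sym (-‿distribˡ-* _ _))

  ratDeriv≈ : ∀ {m} (P Q : Poly m) t {c} → evalPoly Q t ≉ 0# →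
    evalDeriv P t * evalPoly Q t - evalPoly P t * evalDeriv Q t ≈ c * (evalPoly Q t * evalPoly Q t) →
    ratDeriv P Q t ≈ c
  ratDeriv≈ P Q t {c} Q≉0 numerator≈ = trans (*-congʳ numerator≈) (x*y*y⁻¹≈x c (*-≉0 Q≉0 Q≉0))

  monomial : ∀ {m} → Form m → Carrier → Carrier → Fin (suc m) → Carrier
  monomial {m} H x y i = H i * (x ^ toℕ i * y ^ (m ∸ toℕ i))

  evalForm-cong : ∀ {m} (H : Form m) {x x′ y y′} → x ≈ x′ → y ≈ y′ → evalForm H x y ≈ evalForm H x′ y′
  evalForm-cong {m} H x≈x′ y≈y′ =
    Σ-cong (suc m) λ i → *-congˡ {H i} (*-cong (^-congˡ (toℕ i) x≈x′) (^-congˡ (m ∸ toℕ i) y≈y′))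

  evalForm-congᶜ : ∀ {m} {H H′ : Form m} → (∀ i → H i ≈ H′ i) → ∀ x y → evalForm H x y ≈ evalForm H′ x y
  evalForm-congᶜ {m} H≈H′ x y = Σ-cong (suc m) λ i → *-congʳ {x ^ toℕ i * y ^ (m ∸ toℕ i)} (H≈H′ i)

  evalForm-homogeneous : ∀ {m} (H : Form m) t x y → evalForm H (t * x) (t * y) ≈ t ^ m * evalForm H x y
  evalForm-homogeneous {m} H t x y =
    trans (Σ-cong (suc m) monomial-homogeneous) (sym (*-distribˡ-Σ (suc m) (t ^ m) (monomial H x y)))
    where
    monomial-homogeneous : ∀ i → monomial H (t * x) (t * y) i ≈ t ^ m * monomial H x y i
    monomial-homogeneous i = begin
      H i * ((t * x) ^ j * (t * y) ^ (m ∸ j))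
        ≈⟨ *-congˡ (*-cong (^-distrib-* t x j) (^-distrib-* t y (m ∸ j))) ⟩
      H i * ((t ^ j * x ^ j) * (t ^ (m ∸ j) * y ^ (m ∸ j)))
        ≈⟨ *-congˡ (*-interchange (t ^ j) (x ^ j) (t ^ (m ∸ j)) (y ^ (m ∸ j))) ⟩
      H i * ((t ^ j * t ^ (m ∸ j)) * (x ^ j * y ^ (m ∸ j)))
        ≈⟨ *-congˡ (*-congʳ (^-homo-* t j (m ∸ j))) ⟨
      H i * (t ^ (j ℕ.+ (m ∸ j)) * (x ^ j * y ^ (m ∸ j)))
        ≡⟨ ≡.cong (λ e → H i * (t ^ e * (x ^ j * y ^ (m ∸ j)))) (ℕ.m+[n∸m]≡n (toℕ≤pred[n] i)) ⟩
      H i * (t ^ m * (x ^ j * y ^ (m ∸ j)))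
        ≈⟨ x*[y*z]≈y*[x*z] (H i) (t ^ m) _ ⟩
      t ^ m * monomial H x y i ∎
      where j = toℕ i

  evalForm-≈0-rescale : ∀ {m} (H : Form m) {t x y} → t ≉ 0# →
    evalForm H (t * x) (t * y) ≈ 0# → evalForm H x y ≈ 0#
  evalForm-≈0-rescale {m} H {t} {x} {y} t≉0 H[tx,ty]≈0 =
    x*y≈0⇒y≈0 (^-≉0 m t≉0) (trans (sym (evalForm-homogeneous H t x y)) H[tx,ty]≈0)

  evalForm-[1,0] : ∀ {m} (H : Form m) → evalForm H 1# 0# ≈ H (Fin.fromℕ m)
  evalForm-[1,0] {m} H =
    trans (Σ-cong (suc m) λ i → *-congˡ {H i} (trans (*-congʳ (1^k≈1 (toℕ i))) (*-identityˡ (0# ^ (m ∸ toℕ i)))))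
          (only-last m H)
    where
    only-last : ∀ m (g : Fin (suc m) → Carrier) → Σ[ suc m ] (λ i → g i * 0# ^ (m ∸ toℕ i)) ≈ g (Fin.fromℕ m)
    only-last zero    g = trans (+-identityʳ _) (*-identityʳ _)
    only-last (suc m) g =
      trans (+-cong (trans (*-congˡ (zeroˡ _)) (zeroʳ _)) (only-last m (g ∘ suc))) (+-identityˡ _)

  evalForm-[x,1] : ∀ {m} (H : Form m) x → evalForm H x 1# ≈ evalPoly (dehomY H) x
  evalForm-[x,1] {m} H x =
    Σ-cong (suc m) λ i → *-congˡ {H i} (trans (*-congˡ (1^k≈1 (m ∸ toℕ i))) (*-identityʳ (x ^ toℕ i)))

  evalDeriv-∂X : ∀ {k} (H : Form (suc k)) x → evalDeriv (dehomY H) x ≈ evalForm (∂X H) x 1#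
  evalDeriv-∂X {k} H x = begin
    (fromℕ 0 * H zero) * 1# + Σ[ suc k ] (λ j → ∂X H j * x ^ toℕ j)
      ≈⟨ +-congʳ (trans (*-identityʳ _) (zeroˡ _)) ⟩
    0# + Σ[ suc k ] (λ j → ∂X H j * x ^ toℕ j)
      ≈⟨ +-identityˡ _ ⟩
    evalPoly (∂X H) x
      ≈⟨ evalForm-[x,1] (∂X H) x ⟨
    evalForm (∂X H) x 1# ∎

  ∂Y-last : ∀ {m} (F : Form (suc m)) → ∂Y F (Fin.fromℕ m) ≈ F (inject₁ (Fin.fromℕ m))
  ∂Y-last {m} F rewrite toℕ-fromℕ m | ℕ.m+n∸n≡m 1 m =
    trans (*-congʳ (+-identityʳ 1#)) (*-identityˡ _)

  ∂X-penultimate : ∀ {m} (F : Form (suc (suc m))) →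
    ∂X F (inject₁ (Fin.fromℕ m)) ≈ fromℕ (suc m) * F (inject₁ (Fin.fromℕ (suc m)))
  ∂X-penultimate {m} F rewrite toℕ-inject₁ (Fin.fromℕ m) | toℕ-fromℕ m = refl

  ∂X∂Y≈∂Y∂X : ∀ {n} (F : Form (suc (suc n))) j → ∂X (∂Y F) j ≈ ∂Y (∂X F) j
  ∂X∂Y≈∂Y∂X {n} F j rewrite toℕ-inject₁ j =
    x*[y*z]≈y*[x*z] (fromℕ (suc (toℕ j))) (fromℕ (suc n ∸ toℕ j)) (F (suc (inject₁ j)))

  x*∂X≈Σ : ∀ {k} (G : Form (suc k)) x y →
    x * evalForm (∂X G) x y ≈ Σ[ suc (suc k) ] (λ i → fromℕ (toℕ i) * monomial G x y i)
  x*∂X≈Σ {k} G x y = begin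
    x * evalForm (∂X G) x y
      ≈⟨ *-distribˡ-Σ (suc k) x (monomial (∂X G) x y) ⟩
    Σ[ suc k ] (λ j → x * monomial (∂X G) x y j)
      ≈⟨ Σ-cong (suc k) raise ⟩
    Σ[ suc k ] (λ j → fromℕ (suc (toℕ j)) * monomial G x y (suc j))
      ≈⟨ +-identityˡ _ ⟨
    0# + Σ[ suc k ] (λ j → fromℕ (suc (toℕ j)) * monomial G x y (suc j))
      ≈⟨ +-congʳ (zeroˡ (monomial G x y zero)) ⟨
    Σ[ suc (suc k) ] (λ i → fromℕ (toℕ i) * monomial G x y i) ∎
    where
    open *-Solver
    raise : ∀ j → x * monomial (∂X G) x y j ≈ fromℕ (suc (toℕ j)) * monomial G x y (suc j)
    raise j = solve 5 (λ x a g u v → (x ⊕ ((a ⊕ g) ⊕ (u ⊕ v))) ⊜ (a ⊕ (g ⊕ ((x ⊕ u) ⊕ v)))) refl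
      x (fromℕ (suc (toℕ j))) (G (suc j)) (x ^ toℕ j) (y ^ (k ∸ toℕ j))

  y*∂Y≈Σ : ∀ {k} (G : Form (suc k)) x y →
    y * evalForm (∂Y G) x y ≈ Σ[ suc (suc k) ] (λ i → fromℕ (suc k ∸ toℕ i) * monomial G x y i)
  y*∂Y≈Σ {k} G x y = begin
    y * evalForm (∂Y G) x y
      ≈⟨ *-distribˡ-Σ (suc k) y (monomial (∂Y G) x y) ⟩
    Σ[ suc k ] (λ j → y * monomial (∂Y G) x y j)
      ≈⟨ Σ-cong (suc k) raise ⟩
    Σ[ suc k ] (init f)
      ≈⟨ +-identityʳ _ ⟨
    Σ[ suc k ] (init f) + 0#
      ≈⟨ +-congˡ last≈0 ⟨
    Σ[ suc k ] (init f) + f (Fin.fromℕ (suc k))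
      ≈⟨ Σ-init-last (suc k) f ⟨
    Σ[ suc (suc k) ] f ∎
    where
    f : Fin (suc (suc k)) → Carrier
    f i = fromℕ (suc k ∸ toℕ i) * monomial G x y i
    raise : ∀ j → y * ((fromℕ (suc k ∸ toℕ j) * G (inject₁ j)) * (x ^ toℕ j * y ^ (k ∸ toℕ j)))
                  ≈ fromℕ (suc k ∸ toℕ (inject₁ j))
                      * (G (inject₁ j) * (x ^ toℕ (inject₁ j) * y ^ (suc k ∸ toℕ (inject₁ j))))
    raise j rewrite toℕ-inject₁ j | ℕ.+-∸-assoc 1 (toℕ≤pred[n] j) =
      solve 5 (λ y a g u v → (y ⊕ ((a ⊕ g) ⊕ (u ⊕ v))) ⊜ (a ⊕ (g ⊕ (u ⊕ (y ⊕ v))))) refl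
        y (fromℕ (suc (k ∸ toℕ j))) (G (inject₁ j)) (x ^ toℕ j) (y ^ (k ∸ toℕ j))
      where open *-Solver
    last≈0 : fromℕ (suc k ∸ toℕ (Fin.fromℕ (suc k))) * monomial G x y (Fin.fromℕ (suc k)) ≈ 0#
    last≈0 rewrite toℕ-fromℕ k | ℕ.n∸n≡0 k = zeroˡ _

  euler : ∀ {k} (G : Form (suc k)) x y →
    x * evalForm (∂X G) x y + y * evalForm (∂Y G) x y ≈ fromℕ (suc k) * evalForm G x y
  euler {k} G x y = begin
    x * evalForm (∂X G) x y + y * evalForm (∂Y G) x y
      ≈⟨ +-cong (x*∂X≈Σ G x y) (y*∂Y≈Σ G x y) ⟩
    Σ[ d ] (λ i → fromℕ (toℕ i) * monomial G x y i) + Σ[ d ] (λ i → fromℕ (suc k ∸ toℕ i) * monomial G x y i)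
      ≈⟨ Σ-distrib-+ d (λ i → fromℕ (toℕ i) * monomial G x y i) (λ i → fromℕ (suc k ∸ toℕ i) * monomial G x y i) ⟨
    Σ[ d ] (λ i → fromℕ (toℕ i) * monomial G x y i + fromℕ (suc k ∸ toℕ i) * monomial G x y i)
      ≈⟨ Σ-cong d (λ i → weights-sum i (monomial G x y i)) ⟩
    Σ[ d ] (λ i → fromℕ (suc k) * monomial G x y i)
      ≈⟨ *-distribˡ-Σ d (fromℕ (suc k)) (monomial G x y) ⟨
    fromℕ (suc k) * evalForm G x y ∎
    where
    d = suc (suc k)
    weights-sum : ∀ (i : Fin d) z → fromℕ (toℕ i) * z + fromℕ (suc k ∸ toℕ i) * z ≈ fromℕ (suc k) * z
    weights-sum i z = begin
      fromℕ (toℕ i) * z + fromℕ (suc k ∸ toℕ i) * z  ≈⟨ distribʳ z _ _ ⟨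
      (fromℕ (toℕ i) + fromℕ (suc k ∸ toℕ i)) * z    ≈⟨ *-congʳ (fromℕ-homo-+ (toℕ i) _) ⟨
      fromℕ (toℕ i ℕ.+ (suc k ∸ toℕ i)) * z
        ≡⟨ ≡.cong (λ e → fromℕ e * z) (ℕ.m+[n∸m]≡n (toℕ≤pred[n] i)) ⟩
      fromℕ (suc k) * z                             ∎

  -- coeff G t is the coefficient of x^t in G (0 above the degree);
  -- shiftedCoeff s G t is the coefficient of x^t in x^s G.
  coeff : ∀ {n} → (Fin (suc n) → Carrier) → ℕ → Carrier
  coeff G zero = G zero
  coeff {zero}  G (suc t) = 0#
  coeff {suc n} G (suc t) = coeff (tail G) t

  shiftedCoeff : ∀ {n} → ℕ → (Fin (suc n) → Carrier) → ℕ → Carrier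
  shiftedCoeff zero    G t       = coeff G t
  shiftedCoeff (suc s) G zero    = 0#
  shiftedCoeff (suc s) G (suc t) = shiftedCoeff s G t

  coeff-toℕ : ∀ {n} (G : Fin (suc n) → Carrier) k → coeff G (toℕ k) ≡.≡ G k
  coeff-toℕ G zero = ≡.refl
  coeff-toℕ {suc n} G (suc k) = coeff-toℕ (tail G) k

  coeff-init : ∀ {n} (H : Fin (suc (suc n)) → Carrier) → H (Fin.fromℕ (suc n)) ≈ 0# →
    ∀ t → coeff (init H) t ≈ coeff H t
  coeff-init H top≈0 zero = refl
  coeff-init {zero}  H top≈0 (suc zero)    = sym top≈0
  coeff-init {zero}  H top≈0 (suc (suc t)) = refl
  coeff-init {suc n} H top≈0 (suc t)       = coeff-init (tail H) top≈0 t

  Σ-select : ∀ n (G : Fin (suc n) → Carrier) h s t →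
    Σ[ suc n ] (λ j → if does (s ℕ.+ toℕ j ℕ.≟ t) then h * G j else 0#) ≈ h * shiftedCoeff s G t
  Σ-select n G h zero t = select-unshifted n G t
    where
    select-unshifted : ∀ n (G : Fin (suc n) → Carrier) t →
      Σ[ suc n ] (λ j → if does (toℕ j ℕ.≟ t) then h * G j else 0#) ≈ h * coeff G t
    select-unshifted zero    G zero    = +-identityʳ _
    select-unshifted zero    G (suc t) = trans (+-identityʳ 0#) (sym (zeroʳ h))
    select-unshifted (suc n) G zero    = trans (+-congˡ (Σ-≈0 (suc n) (λ _ → refl))) (+-identityʳ _)
    select-unshifted (suc n) G (suc t) = trans (+-identityˡ _) (select-unshifted n (tail G) t)
  Σ-select n G h (suc s) zero    = trans (Σ-≈0 (suc n) (λ _ → refl)) (sym (zeroʳ h))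
  Σ-select n G h (suc s) (suc t) = Σ-select n G h s t

  mulForm-sqLinear : ∀ {n} a b (G : Form n) (k : Fin (suc (suc (suc n)))) →
    mulForm (sqLinear a b) G k ≈
      (a * a) * coeff G (toℕ k)
        + ((- ((a * b) + (a * b))) * shiftedCoeff 1 G (toℕ k) + ((b * b) * shiftedCoeff 2 G (toℕ k) + 0#))
  mulForm-sqLinear {n} a b G k =
    +-cong (Σ-select n G (a * a) 0 (toℕ k))
      (+-cong (Σ-select n G (- ((a * b) + (a * b))) 1 (toℕ k))
        (+-congʳ (Σ-select n G (b * b) 2 (toℕ k))))

  -- p = (x - r) · quotient r p + p(r)  (synthetic division)
  quotient : ∀ {k} → Carrier → Poly (suc k) → Poly k
  quotient r p zero = evalPoly (tail p) r
  quotient {suc k} r p (suc j) = quotient r (tail p) j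

  head≈-r*quotient+eval : ∀ {k} r (p : Poly (suc k)) → p zero ≈ (- r) * quotient r p zero + evalPoly p r
  head≈-r*quotient+eval r p = sym (begin
    (- r) * T + evalPoly p r      ≈⟨ +-congˡ (evalPoly-horner p r) ⟩
    (- r) * T + (p zero + r * T)  ≈⟨ x+[y+z]≈y+[x+z] ((- r) * T) (p zero) (r * T) ⟩
    p zero + ((- r) * T + r * T)  ≈⟨ +-congˡ (distribʳ T (- r) r) ⟨
    p zero + (- r + r) * T        ≈⟨ +-congˡ (trans (*-congʳ (-‿inverseˡ r)) (zeroˡ T)) ⟩
    p zero + 0#                   ≈⟨ +-identityʳ (p zero) ⟩
    p zero                        ∎)
    where T = quotient r p zero

  coeff-suc-quotient : ∀ {k} r (p : Poly (suc k)) t →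
    coeff p (suc t) ≈ (- r) * coeff (quotient r p) (suc t) + coeff (quotient r p) t
  coeff-suc-quotient {zero} r p zero =
    sym (trans (+-congʳ (zeroʳ (- r))) (trans (+-identityˡ _) (evalPoly-const (tail p) r)))
  coeff-suc-quotient {zero}  r p (suc t) = sym (trans (+-congʳ (zeroʳ (- r))) (+-identityˡ 0#))
  coeff-suc-quotient {suc k} r p zero    = head≈-r*quotient+eval r (tail p)
  coeff-suc-quotient {suc k} r p (suc t) = coeff-suc-quotient r (tail p) t

  coeff-factor : ∀ {k} r (p : Poly (suc k)) → evalPoly p r ≈ 0# → ∀ t →
    coeff p t ≈ (- r) * coeff (quotient r p) t + shiftedCoeff 1 (quotient r p) t
  coeff-factor r p p[r]≈0 zero    = trans (head≈-r*quotient+eval r p) (+-congˡ p[r]≈0)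
  coeff-factor r p p[r]≈0 (suc t) = coeff-suc-quotient r p t

  shiftedCoeff-factor : ∀ {k} r (p : Poly (suc k)) → evalPoly p r ≈ 0# → ∀ t →
    shiftedCoeff 1 p t ≈ (- r) * shiftedCoeff 1 (quotient r p) t + shiftedCoeff 2 (quotient r p) t
  shiftedCoeff-factor r p p[r]≈0 zero    = sym (trans (+-identityʳ _) (zeroʳ (- r)))
  shiftedCoeff-factor r p p[r]≈0 (suc t) = coeff-factor r p p[r]≈0 t

  evalPoly-quotient : ∀ {k} r (p : Poly (suc k)) → evalPoly (quotient r p) r ≈ evalDeriv p r
  evalPoly-quotient {zero} r p = begin
    evalPoly (quotient r p) r                       ≈⟨ evalPoly-const (quotient r p) r ⟩
    evalPoly (tail p) r                             ≈⟨ +-identityʳ _ ⟨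
    evalPoly (tail p) r + 0#                        ≈⟨ +-congˡ (trans (*-congˡ (evalDeriv-const (tail p) r)) (zeroʳ r)) ⟨
    evalPoly (tail p) r + r * evalDeriv (tail p) r  ≈⟨ evalDeriv-horner p r ⟨
    evalDeriv p r                                   ∎
  evalPoly-quotient {suc k} r p = begin
    evalPoly (quotient r p) r                                ≈⟨ evalPoly-horner (quotient r p) r ⟩
    evalPoly (tail p) r + r * evalPoly (quotient r (tail p)) r ≈⟨ +-congˡ (*-congˡ (evalPoly-quotient r (tail p))) ⟩
    evalPoly (tail p) r + r * evalDeriv (tail p) r           ≈⟨ evalDeriv-horner p r ⟨
    evalDeriv p r                                            ∎

  affineDoubleRoot⇒multipleRoot : ∀ {n} (F : Form (suc (suc n))) r →
    evalPoly (dehomY F) r ≈ 0# → evalDeriv (dehomY F) r ≈ 0# → HasMultipleRoot F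
  affineDoubleRoot⇒multipleRoot F r f[r]≈0 f′[r]≈0 =
    r , 1# , (λ (_ , 1≈0) → 0≉1 (sym 1≈0)) , G , F≈[X-rY]²G
    where
    q = quotient r F
    G = quotient r q
    q[r]≈0 : evalPoly q r ≈ 0#
    q[r]≈0 = trans (evalPoly-quotient r F) f′[r]≈0
    expand : ∀ e₀ e₁ e₂ → (- r) * ((- r) * e₀ + e₁) + ((- r) * e₁ + e₂) ≈
      (r * r) * e₀ + ((- ((r * 1#) + (r * 1#))) * e₁ + ((1# * 1#) * e₂ + 0#))
    expand e₀ e₁ e₂ = begin
      (- r) * ((- r) * e₀ + e₁) + ((- r) * e₁ + e₂)
        ≈⟨ +-congʳ (trans (distribˡ (- r) _ e₁) (+-congʳ (trans (sym (*-assoc _ _ e₀)) (*-congʳ (-x*-y≈x*y r r))))) ⟩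
      ((r * r) * e₀ + (- r) * e₁) + ((- r) * e₁ + e₂)
        ≈⟨ +-assoc _ _ _ ⟩
      (r * r) * e₀ + ((- r) * e₁ + ((- r) * e₁ + e₂))
        ≈⟨ +-congˡ (sym (+-assoc _ _ _)) ⟩
      (r * r) * e₀ + (((- r) * e₁ + (- r) * e₁) + e₂)
        ≈⟨ +-congˡ (+-cong (sym twice-r) (sym (trans (+-identityʳ _) (trans (*-congʳ (*-identityʳ 1#)) (*-identityˡ e₂))))) ⟩
      (r * r) * e₀ + ((- ((r * 1#) + (r * 1#))) * e₁ + ((1# * 1#) * e₂ + 0#)) ∎
      where
      twice-r : (- ((r * 1#) + (r * 1#))) * e₁ ≈ (- r) * e₁ + (- r) * e₁
      twice-r = trans (*-congʳ (trans (-‿cong (+-cong (*-identityʳ r) (*-identityʳ r))) (sym (-‿+-comm r r))))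
                      (distribʳ e₁ (- r) (- r))
    F≈[X-rY]²G : ∀ k → F k ≈ mulForm (sqLinear r 1#) G k
    F≈[X-rY]²G k = begin
      F k              ≡⟨ coeff-toℕ F k ⟨
      coeff F t        ≈⟨ coeff-factor r F f[r]≈0 t ⟩
      (- r) * coeff q t + shiftedCoeff 1 q t
        ≈⟨ +-cong (*-congˡ (coeff-factor r q q[r]≈0 t)) (shiftedCoeff-factor r q q[r]≈0 t) ⟩
      (- r) * ((- r) * coeff G t + shiftedCoeff 1 G t) + ((- r) * shiftedCoeff 1 G t + shiftedCoeff 2 G t)
        ≈⟨ expand (coeff G t) (shiftedCoeff 1 G t) (shiftedCoeff 2 G t) ⟩
      (r * r) * coeff G t + ((- ((r * 1#) + (r * 1#))) * shiftedCoeff 1 G t + ((1# * 1#) * shiftedCoeff 2 G t + 0#))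
        ≈⟨ mulForm-sqLinear r 1# G k ⟨
      mulForm (sqLinear r 1#) G k ∎
      where t = toℕ k

  leadingZeros⇒multipleRoot : ∀ {n} (F : Form (suc (suc n))) →
    F (Fin.fromℕ (suc (suc n))) ≈ 0# → F (inject₁ (Fin.fromℕ (suc n))) ≈ 0# → HasMultipleRoot F
  leadingZeros⇒multipleRoot {n} F top≈0 next≈0 =
    1# , 0# , (λ (1≈0 , _) → 0≉1 (sym 1≈0)) , G , F≈Y²G
    where
    G : Form n
    G = init (init F)
    expand : ∀ e₀ e₁ e₂ → e₀ ≈ (1# * 1#) * e₀ + ((- ((1# * 0#) + (1# * 0#))) * e₁ + ((0# * 0#) * e₂ + 0#))
    expand e₀ e₁ e₂ = sym (begin
      (1# * 1#) * e₀ + ((- ((1# * 0#) + (1# * 0#))) * e₁ + ((0# * 0#) * e₂ + 0#))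
        ≈⟨ +-cong (trans (*-congʳ (*-identityʳ 1#)) (*-identityˡ e₀)) (+-cong middle≈0 last≈0) ⟩
      e₀ + (0# + 0#)  ≈⟨ +-congˡ (+-identityʳ 0#) ⟩
      e₀ + 0#         ≈⟨ +-identityʳ e₀ ⟩
      e₀              ∎)
      where
      middle≈0 = trans (*-congʳ (x≈0⇒-x≈0 (trans (+-cong (zeroʳ 1#) (zeroʳ 1#)) (+-identityʳ 0#)))) (zeroˡ e₁)
      last≈0 = trans (+-identityʳ _) (trans (*-congʳ (zeroˡ 0#)) (zeroˡ e₂))
    F≈Y²G : ∀ k → F k ≈ mulForm (sqLinear 1# 0#) G k
    F≈Y²G k = begin
      F k                   ≡⟨ coeff-toℕ F k ⟨
      coeff F t             ≈⟨ coeff-init F top≈0 t ⟨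
      coeff (init F) t      ≈⟨ coeff-init (init F) next≈0 t ⟨
      coeff G t             ≈⟨ expand (coeff G t) (shiftedCoeff 1 G t) (shiftedCoeff 2 G t) ⟩
      (1# * 1#) * coeff G t + ((- ((1# * 0#) + (1# * 0#))) * shiftedCoeff 1 G t + ((0# * 0#) * shiftedCoeff 2 G t + 0#))
        ≈⟨ mulForm-sqLinear 1# 0# G k ⟨
      mulForm (sqLinear 1# 0#) G k ∎
      where t = toℕ k

  singularRoot⇒¬¬multipleRoot : ∀ {n} (F : Form (suc (suc n))) {a b} → NonZeroPair a b →
    evalForm F a b ≈ 0# → evalForm (∂X F) a b ≈ 0# → evalForm (∂Y F) a b ≈ 0# → ¬ ¬ HasMultipleRoot F
  singularRoot⇒¬¬multipleRoot {n} F {a} {b} ab≉0 F≈0 FX≈0 FY≈0 noMultipleRoot =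
    -- b ≈ 0# is undecidable, but the goal is negative, so excluded middle is available.
    ¬¬-excluded-middle λ where
      (yes b≈0) → noMultipleRoot (atInfinity b≈0)
      (no b≉0)  → noMultipleRoot (affine b≉0)
    where
    atInfinity : b ≈ 0# → HasMultipleRoot F
    atInfinity b≈0 = leadingZeros⇒multipleRoot F
      (trans (sym (evalForm-[1,0] F)) (vanishes-at-[1,0] F F≈0))
      (trans (sym (∂Y-last F)) (trans (sym (evalForm-[1,0] (∂Y F))) (vanishes-at-[1,0] (∂Y F) FY≈0)))
      where
      a≉0 : a ≉ 0#
      a≉0 a≈0 = ab≉0 (a≈0 , b≈0)
      vanishes-at-[1,0] : ∀ {m} (H : Form m) → evalForm H a b ≈ 0# → evalForm H 1# 0# ≈ 0#
      vanishes-at-[1,0] H H≈0 = evalForm-≈0-rescale H a≉0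
        (trans (evalForm-cong H (*-identityʳ a) (trans (zeroʳ a) (sym b≈0))) H≈0)
    affine : b ≉ 0# → HasMultipleRoot F
    affine b≉0 = affineDoubleRoot⇒multipleRoot F r
      (trans (sym (evalForm-[x,1] F r)) (vanishes-at-[r,1] F F≈0))
      (trans (evalDeriv-∂X F r) (vanishes-at-[r,1] (∂X F) FX≈0))
      where
      r = a * b ⁻¹
      b*r≈a : b * r ≈ a
      b*r≈a = trans (x*[y*z]≈y*[x*z] b a (b ⁻¹)) (trans (*-congˡ (⁻¹-inverse b b≉0)) (*-identityʳ a))
      vanishes-at-[r,1] : ∀ {m} (H : Form m) → evalForm H a b ≈ 0# → evalForm H r 1# ≈ 0#
      vanishes-at-[r,1] H H≈0 = evalForm-≈0-rescale H b≉0
        (trans (evalForm-cong H b*r≈a (*-identityʳ b)) H≈0)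

  v*b≈-u*a⇒a*u+b*v≈0 : ∀ {a b u v} → v * b ≈ (- u) * a → a * u + b * v ≈ 0#
  v*b≈-u*a⇒a*u+b*v≈0 {a} {b} {u} {v} v*b≈-u*a = begin
    a * u + b * v       ≈⟨ +-congˡ (trans (*-comm b v) v*b≈-u*a) ⟩
    a * u + (- u) * a   ≈⟨ +-congˡ (trans (sym (-‿distribˡ-* u a)) (-‿cong (*-comm u a))) ⟩
    a * u + - (a * u)   ≈⟨ -‿inverseʳ (a * u) ⟩
    0#                  ∎

  a*u+b*v≈0⇒v*b≈-u*a : ∀ {a b u v} → a * u + b * v ≈ 0# → v * b ≈ (- u) * a
  a*u+b*v≈0⇒v*b≈-u*a {a} {b} {u} {v} a*u+b*v≈0 = begin
    v * b        ≈⟨ *-comm v b ⟩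
    b * v        ≈⟨ +-inverseʳ-unique (a * u) (b * v) a*u+b*v≈0 ⟩
    - (a * u)    ≈⟨ -‿cong (*-comm a u) ⟩
    - (u * a)    ≈⟨ -‿distribˡ-* u a ⟩
    (- u) * a    ∎

  fixedPoint⇒root : ∀ {n} (F : Form (suc (suc n))) {a b} → fromℕ (suc (suc n)) ≉ 0# →
    IsFixedPoint F a b → evalForm F a b ≈ 0#
  fixedPoint⇒root F {a} {b} d≉0 (_ , fixed) =
    x*y≈0⇒y≈0 d≉0 (trans (sym (euler F a b)) (v*b≈-u*a⇒a*u+b*v≈0 fixed))

  root⇒fixedPoint : ∀ {n} (F : Form (suc (suc n))) {a b} → ¬ HasMultipleRoot F → NonZeroPair a b →
    evalForm F a b ≈ 0# → IsFixedPoint F a b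
  root⇒fixedPoint F {a} {b} noMultipleRoot ab≉0 F≈0 = image≉0 , a*u+b*v≈0⇒v*b≈-u*a euler-sum≈0
    where
    euler-sum≈0 : a * evalForm (∂X F) a b + b * evalForm (∂Y F) a b ≈ 0#
    euler-sum≈0 = trans (euler F a b) (trans (*-congˡ F≈0) (zeroʳ _))
    image≉0 : NonZeroPair (evalForm (∂Y F) a b) (- evalForm (∂X F) a b)
    image≉0 (FY≈0 , -FX≈0) =
      singularRoot⇒¬¬multipleRoot F ab≉0 F≈0 (-x≈0⇒x≈0 -FX≈0) FY≈0 noMultipleRoot

  multiplierFinite-fixed : ∀ {n} (F : Form (suc (suc n))) a → IsFixedPoint F a 1# →
    multiplierFinite F a ≈ 1# - fromℕ (suc (suc n))
  multiplierFinite-fixed {n} F a (image≉0 , fixed) =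
    trans (ratDeriv≈ P Q a q≉0 numerator) (sym (1-[2+n]≈-[1+n] n))
    where
    P = dehomY (∂Y F)
    Q = dehomY (negForm (∂X F))
    M = fromℕ (suc n)
    q = evalPoly Q a
    F_X = evalForm (∂X F) a 1#
    F_XX = evalForm (∂X (∂X F)) a 1#
    q≈-F_X : q ≈ - F_X
    q≈-F_X = trans (evalPoly-neg (∂X F) a) (-‿cong (sym (evalForm-[x,1] (∂X F) a)))
    F_X≈-q : F_X ≈ - q
    F_X≈-q = trans (sym (-‿involutive F_X)) (-‿cong (sym q≈-F_X))
    F_Y≈q*a : evalForm (∂Y F) a 1# ≈ q * a
    F_Y≈q*a = trans (sym (*-identityʳ _)) (trans fixed (*-congʳ (sym q≈-F_X)))
    q≉0 : q ≉ 0#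
    q≉0 q≈0 = image≉0 (trans F_Y≈q*a (trans (*-congʳ q≈0) (zeroˡ a)) , trans (sym q≈-F_X) q≈0)
    Q′[a]≈-F_XX : evalDeriv Q a ≈ - F_XX
    Q′[a]≈-F_XX = trans (evalDeriv-neg (∂X F) a) (-‿cong (evalDeriv-∂X (∂X F) a))
    -- Euler's identity for F_X at (a, 1): a F_XX + F_XY = (d - 1) F_X.
    P′[a]≈-Mq-aF_XX : evalDeriv P a ≈ - (M * q) + - (a * F_XX)
    P′[a]≈-Mq-aF_XX = begin
      evalDeriv P a                            ≈⟨ evalDeriv-∂X (∂Y F) a ⟩
      evalForm (∂X (∂Y F)) a 1#                ≈⟨ evalForm-congᶜ (∂X∂Y≈∂Y∂X F) a 1# ⟩
      evalForm (∂Y (∂X F)) a 1#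
        ≈⟨ x+y≈z⇒y≈z-x (trans (+-congˡ (sym (*-identityˡ _))) (euler (∂X F) a 1#)) ⟩
      M * F_X - a * F_XX                       ≈⟨ +-congʳ (trans (*-congˡ F_X≈-q) (sym (-‿distribʳ-* M q))) ⟩
      - (M * q) + - (a * F_XX)                 ∎
    numerator : evalDeriv P a * q - evalPoly P a * evalDeriv Q a ≈ (- M) * (q * q)
    numerator = begin
      evalDeriv P a * q - evalPoly P a * evalDeriv Q a
        ≈⟨ +-cong (*-congʳ P′[a]≈-Mq-aF_XX) (-‿cong (*-cong P[a]≈q*a Q′[a]≈-F_XX)) ⟩
      (- (M * q) + - (a * F_XX)) * q - (q * a) * (- F_XX)
        ≈⟨ +-cong (distribʳ q _ _) (trans (-‿cong (sym (-‿distribʳ-* (q * a) F_XX))) (-‿involutive _)) ⟩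
      ((- (M * q)) * q + (- (a * F_XX)) * q) + (q * a) * F_XX
        ≈⟨ +-congʳ (+-congˡ (trans (sym (-‿distribˡ-* (a * F_XX) q)) (-‿cong a*F_XX*q≈q*a*F_XX))) ⟩
      ((- (M * q)) * q + - ((q * a) * F_XX)) + (q * a) * F_XX
        ≈⟨ +-assoc _ _ _ ⟩
      (- (M * q)) * q + (- ((q * a) * F_XX) + (q * a) * F_XX)
        ≈⟨ +-congˡ (-‿inverseˡ _) ⟩
      (- (M * q)) * q + 0#
        ≈⟨ +-identityʳ _ ⟩
      (- (M * q)) * q
        ≈⟨ -‿distribˡ-* (M * q) q ⟨
      - ((M * q) * q)
        ≈⟨ -‿cong (*-assoc M q q) ⟩
      - (M * (q * q))
        ≈⟨ -‿distribˡ-* M (q * q) ⟩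
      (- M) * (q * q) ∎
      where
      P[a]≈q*a : evalPoly P a ≈ q * a
      P[a]≈q*a = trans (sym (evalForm-[x,1] (∂Y F) a)) F_Y≈q*a
      a*F_XX*q≈q*a*F_XX : (a * F_XX) * q ≈ (q * a) * F_XX
      a*F_XX*q≈q*a*F_XX = trans (*-comm _ q) (sym (*-assoc q a F_XX))

  multiplierInfinity-fixed : ∀ {n} (F : Form (suc (suc n))) → IsFixedPoint F 1# 0# →
    multiplierInfinity F ≈ 1# - fromℕ (suc (suc n))
  multiplierInfinity-fixed {n} F (image≉0 , fixed) =
    trans (ratDeriv≈ P Q 0# Q[0]≉0 numerator) (sym (1-[2+n]≈-[1+n] n))
    where
    P = dehomX (negForm (∂X F))
    Q = dehomX (∂Y F)
    M = fromℕ (suc n)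
    -F_X≈0 : - evalForm (∂X F) 1# 0# ≈ 0#
    -F_X≈0 = trans (sym (*-identityʳ _)) (trans (sym fixed) (zeroʳ _))
    Q[0]≈F_Y : evalPoly Q 0# ≈ evalForm (∂Y F) 1# 0#
    Q[0]≈F_Y = trans (evalPoly-at-0 Q) (sym (evalForm-[1,0] (∂Y F)))
    Q[0]≉0 : evalPoly Q 0# ≉ 0#
    Q[0]≉0 Q[0]≈0 = image≉0 (trans (sym Q[0]≈F_Y) Q[0]≈0 , -F_X≈0)
    P[0]≈0 : evalPoly P 0# ≈ 0#
    P[0]≈0 = trans (evalPoly-at-0 P) (trans (-‿cong (sym (evalForm-[1,0] (∂X F)))) -F_X≈0)
    P′[0]≈-M*Q[0] : evalDeriv P 0# ≈ - (M * evalPoly Q 0#)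
    P′[0]≈-M*Q[0] = trans (evalDeriv-at-0 P)
      (-‿cong (trans (∂X-penultimate F) (*-congˡ (sym (trans (evalPoly-at-0 Q) (∂Y-last F))))))
    numerator : evalDeriv P 0# * evalPoly Q 0# - evalPoly P 0# * evalDeriv Q 0# ≈ (- M) * (evalPoly Q 0# * evalPoly Q 0#)
    numerator = begin
      evalDeriv P 0# * Q₀ - evalPoly P 0# * evalDeriv Q 0#
        ≈⟨ +-cong (*-congʳ P′[0]≈-M*Q[0]) (x≈0⇒-x≈0 (trans (*-congʳ P[0]≈0) (zeroˡ _))) ⟩
      (- (M * Q₀)) * Q₀ + 0#  ≈⟨ +-identityʳ _ ⟩
      (- (M * Q₀)) * Q₀       ≈⟨ -‿distribˡ-* (M * Q₀) Q₀ ⟨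
      - ((M * Q₀) * Q₀)       ≈⟨ -‿cong (*-assoc M Q₀ Q₀) ⟩
      - (M * (Q₀ * Q₀))       ≈⟨ -‿distribˡ-* M (Q₀ * Q₀) ⟩
      (- M) * (Q₀ * Q₀)       ∎
      where Q₀ = evalPoly Q 0#

open BinaryForms using (fixedPoint⇒root; root⇒fixedPoint; multiplierFinite-fixed; multiplierInfinity-fixed)

mainTheorem3 : {c ℓ : Level} (K : Field c ℓ) → let open FieldTheory K in
    (n : ℕ) → (F : Form (suc (suc n))) →
    ¬ (fromℕ (suc (suc n)) ≈ 0#) →
    ¬ HasMultipleRoot F →
    ((a b : Carrier) → NonZeroPair a b →
        (IsFixedPoint F a b → evalForm F a b ≈ 0#) × (evalForm F a b ≈ 0# → IsFixedPoint F a b))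
    × ((a : Carrier) → IsFixedPoint F a 1# → multiplierFinite F a ≈ 1# - fromℕ (suc (suc n)))
    × (IsFixedPoint F 1# 0# → multiplierInfinity F ≈ 1# - fromℕ (suc (suc n)))
mainTheorem3 K n F d≉0 noMultipleRoot =
  (λ a b ab≉0 → fixedPoint⇒root K F d≉0 , root⇒fixedPoint K F noMultipleRoot ab≉0) ,
  multiplierFinite-fixed K F ,
  multiplierInfinity-fixed K F
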